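{- For all natural numbers $n, k$ with $n \geq k \geq 0$, the integer $$\left[\begin{array}{c} n \\ k \end{array}\right] := \frac{\mathrm{lcm}(n, n-1, \dots, n-k+1)}{\mathrm{lcm}(1, 2, \dots, k)}$$ divides the binomial coefficient $\binom{n}{k}$.
   Context: The least common multiple of the empty set is taken to be $1$ (so the expression equals $1$ when $k=0$). $\mathbb{N}$ denotes the set of nonnegative integers. -}

module Defs where

open import Data.Nat using (ℕ; zero; suc; _+_; _∸_)
open import Data.Nat.LCM using (lcm)

lcmRange : ℕ → ℕ → ℕ
lcmRange a zero    = 1
lcmRange a (suc k) = lcm (a + suc k) (lcmRange a k)

-- lcm(n, n-1, ..., n-k+1) = lcmRange (n ∸ k) k  (for k ≤ n)
topLcm : ℕ → ℕ → ℕ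
topLcm n k = lcmRange (n ∸ k) k

botLcm : ℕ → ℕ
botLcm k = lcmRange 0 k

{-# OPTIONS --safe #-}
module Submission where

-- Every divisor t ≤ k of lcm(1, …, k) has a multiple among any k consecutive
-- integers, so lcm(1, …, k) divides lcm(a+1, …, a+k) and the quotient q exists.
-- For 1 ≤ i ≤ k, the absorption identity (m+1)·C(m, k-1) = k·C(m+1, k) makes
-- m+1 divide lcm(1, …, k)·C(m+1, k), and Pascal's rule propagates this to
-- lcm(1, …, k)·C(m+1+j, k) for all j < k.  Hence lcm(a+1, …, a+k) divides
-- lcm(1, …, k)·C(a+k, k), and cancelling lcm(1, …, k) gives q ∣ C(a+k, k).

open import Defs
open import Data.Nat using (ℕ; zero; suc; _+_; _*_; _∸_; _≤_; _<_; z≤n; s≤s; NonZero; ≢-nonZero; _/_; _%_)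
open import Data.Nat.Properties
open import Data.Nat.Divisibility
open import Data.Nat.DivMod using (m≡m%n+[m/n]*n; m%n<n)
open import Data.Nat.GCD using (gcd)
open import Data.Nat.LCM using (lcm; m∣lcm[m,n]; n∣lcm[m,n]; lcm-least; gcd*lcm)
open import Data.Nat.Combinatorics using (_C_; nCk+nC[k+1]≡[n+1]C[k+1]; nC1≡n)
open import Data.Nat.Combinatorics.Specification using (k>n⇒nCk≡0)
open import Data.Nat.Solver using (module +-*-Solver)
open import Data.Product using (Σ; ∃; _×_; _,_)
open import Data.Sum using (inj₁; inj₂)
open import Relation.Binary.PropositionalEquality

[1+k]*[1+m]C[1+k]≡[1+m]*mCk : ∀ m k → suc k * (suc m C suc k) ≡ suc m * (m C k)
[1+k]*[1+m]C[1+k]≡[1+m]*mCk zero zero = refl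
[1+k]*[1+m]C[1+k]≡[1+m]*mCk zero (suc k) = begin
  suc (suc k) * (1 C suc (suc k)) ≡⟨ cong (suc (suc k) *_) (k>n⇒nCk≡0 {1} {suc (suc k)} (s≤s (s≤s z≤n))) ⟩
  suc (suc k) * 0                 ≡⟨ *-zeroʳ (suc (suc k)) ⟩
  0                               ≡⟨ cong (1 *_) (k>n⇒nCk≡0 {0} {suc k} (s≤s z≤n)) ⟨
  1 * (0 C suc k)                 ∎
  where open ≡-Reasoning
[1+k]*[1+m]C[1+k]≡[1+m]*mCk (suc m) zero = begin
  1 * (suc (suc m) C 1) ≡⟨ *-identityˡ _ ⟩
  suc (suc m) C 1       ≡⟨ nC1≡n (suc (suc m)) ⟩
  suc (suc m)           ≡⟨ *-identityʳ _ ⟨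
  suc (suc m) * 1       ∎
  where open ≡-Reasoning
[1+k]*[1+m]C[1+k]≡[1+m]*mCk (suc m) (suc k) = begin
  suc (suc k) * (suc (suc m) C suc (suc k))
    ≡⟨ cong (suc (suc k) *_) (nCk+nC[k+1]≡[n+1]C[k+1] (suc m) (suc k)) ⟨
  suc (suc k) * (A + B)
    ≡⟨ solve 3 (λ k A B → (con 2 :+ k) :* (A :+ B) := (con 1 :+ k) :* A :+ (con 2 :+ k) :* B :+ A) refl k A B ⟩
  suc k * A + suc (suc k) * B + A
    ≡⟨ cong₂ (λ x y → x + y + A) ([1+k]*[1+m]C[1+k]≡[1+m]*mCk m k) ([1+k]*[1+m]C[1+k]≡[1+m]*mCk m (suc k)) ⟩
  suc m * (m C k) + suc m * (m C suc k) + A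
    ≡⟨ cong (_+ A) (*-distribˡ-+ (suc m) (m C k) (m C suc k)) ⟨
  suc m * (m C k + m C suc k) + A
    ≡⟨ cong (λ x → suc m * x + A) (nCk+nC[k+1]≡[n+1]C[k+1] m k) ⟩
  suc m * A + A
    ≡⟨ solve 2 (λ m A → (con 1 :+ m) :* A :+ A := (con 2 :+ m) :* A) refl m A ⟩
  suc (suc m) * A ∎
  where
  open ≡-Reasoning
  open +-*-Solver
  A = suc m C suc k
  B = suc m C suc (suc k)

lcmRange-member : ∀ a {i k} → 1 ≤ i → i ≤ k → a + i ∣ lcmRange a k
lcmRange-member a {suc _} {zero}  _   ()
lcmRange-member a {i}     {suc k} 1≤i i≤1+k with m≤n⇒m<n∨m≡n i≤1+k
... | inj₂ refl      = m∣lcm[m,n] (a + suc k) (lcmRange a k)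
... | inj₁ (s≤s i≤k) = ∣-trans (lcmRange-member a 1≤i i≤k) (n∣lcm[m,n] (a + suc k) (lcmRange a k))

lcmRange-least : ∀ a k {x} → (∀ i → 1 ≤ i → i ≤ k → a + i ∣ x) → lcmRange a k ∣ x
lcmRange-least a zero    all∣x = 1∣ _
lcmRange-least a (suc k) all∣x =
  lcm-least (all∣x (suc k) (s≤s z≤n) ≤-refl)
            (lcmRange-least a k (λ i 1≤i i≤k → all∣x i 1≤i (m≤n⇒m≤1+n i≤k)))

lcm≢0 : ∀ {m n} → m ≢ 0 → n ≢ 0 → lcm m n ≢ 0
lcm≢0 {m} {n} m≢0 n≢0 lcm≡0 with m*n≡0⇒m≡0∨n≡0 m m*n≡0
  where
  m*n≡0 : m * n ≡ 0
  m*n≡0 = begin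
    m * n               ≡⟨ gcd*lcm m n ⟨
    gcd m n * lcm m n   ≡⟨ cong (gcd m n *_) lcm≡0 ⟩
    gcd m n * 0         ≡⟨ *-zeroʳ (gcd m n) ⟩
    0                   ∎
    where open ≡-Reasoning
... | inj₁ m≡0 = m≢0 m≡0
... | inj₂ n≡0 = n≢0 n≡0

lcmRange≢0 : ∀ a k → lcmRange a k ≢ 0
lcmRange≢0 a zero    ()
lcmRange≢0 a (suc k) = lcm≢0 (subst (_≢ 0) (sym (+-suc a k)) λ ()) (lcmRange≢0 a k)

multiple-in-window : ∀ a t → .{{NonZero t}} → ∃ λ i → 1 ≤ i × i ≤ t × t ∣ a + i
multiple-in-window a t = t ∸ r , m<n⇒0<n∸m r<t , m∸n≤m t r , divides (q + 1) a+i≡[q+1]*t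
  where
  r = a % t
  q = a / t
  r<t : r < t
  r<t = m%n<n a t
  a+i≡[q+1]*t : a + (t ∸ r) ≡ (q + 1) * t
  a+i≡[q+1]*t = begin
    a + (t ∸ r)           ≡⟨ cong (_+ (t ∸ r)) (m≡m%n+[m/n]*n a t) ⟩
    r + q * t + (t ∸ r)   ≡⟨ solve 3 (λ r qt i → r :+ qt :+ i := qt :+ (r :+ i)) refl r (q * t) (t ∸ r) ⟩
    q * t + (r + (t ∸ r)) ≡⟨ cong (q * t +_) (m+[n∸m]≡n (<⇒≤ r<t)) ⟩
    q * t + t             ≡⟨ solve 2 (λ q t → q :* t :+ t := (q :+ con 1) :* t) refl q t ⟩
    (q + 1) * t           ∎
    where
    open ≡-Reasoning
    open +-*-Solver

botLcm∣lcmRange : ∀ a k → botLcm k ∣ lcmRange a k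
botLcm∣lcmRange a k = lcmRange-least 0 k t∣lcmRange
  where
  t∣lcmRange : ∀ t → 1 ≤ t → t ≤ k → t ∣ lcmRange a k
  t∣lcmRange t@(suc _) _ t≤k with multiple-in-window a t
  ... | i , 1≤i , i≤t , t∣a+i = ∣-trans t∣a+i (lcmRange-member a 1≤i (≤-trans i≤t t≤k))

1+m∣botLcm*[1+m+j]Ck : ∀ m j k → j < k → suc m ∣ botLcm k * ((suc m + j) C k)
1+m∣botLcm*[1+m+j]Ck m zero (suc k) _ = begin
  suc m                               ∣⟨ m∣m*n (m C k) ⟩
  suc m * (m C k)                     ≡⟨ [1+k]*[1+m]C[1+k]≡[1+m]*mCk m k ⟨
  suc k * (suc m C suc k)             ∣⟨ *-monoˡ-∣ _ (m∣lcm[m,n] (suc k) (botLcm k)) ⟩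
  botLcm (suc k) * (suc m C suc k)    ≡⟨ cong (λ x → botLcm (suc k) * (x C suc k)) (+-identityʳ (suc m)) ⟨
  botLcm (suc k) * ((suc m + 0) C suc k) ∎
  where open ∣-Reasoning
1+m∣botLcm*[1+m+j]Ck m (suc j) (suc k) (s≤s j<k) = begin
  suc m
    ∣⟨ ∣m∣n⇒∣m+n (∣-trans (1+m∣botLcm*[1+m+j]Ck m j k j<k) (*-monoˡ-∣ _ (n∣lcm[m,n] (suc k) (botLcm k))))
                 (1+m∣botLcm*[1+m+j]Ck m j (suc k) (m≤n⇒m≤1+n j<k)) ⟩
  L * (N C k) + L * (N C suc k) ≡⟨ *-distribˡ-+ L (N C k) (N C suc k) ⟨
  L * (N C k + N C suc k)       ≡⟨ cong (L *_) (nCk+nC[k+1]≡[n+1]C[k+1] N k) ⟩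
  L * (suc N C suc k)           ≡⟨ cong (λ x → L * (x C suc k)) (+-suc (suc m) j) ⟨
  L * ((suc m + suc j) C suc k) ∎
  where
  open ∣-Reasoning
  L = botLcm (suc k)
  N = suc m + j

lcmRange∣botLcm*[a+k]Ck : ∀ a k → lcmRange a k ∣ botLcm k * ((a + k) C k)
lcmRange∣botLcm*[a+k]Ck a k = lcmRange-least a k a+i∣
  where
  a+i∣ : ∀ i → 1 ≤ i → i ≤ k → a + i ∣ botLcm k * ((a + k) C k)
  a+i∣ (suc i) _ (s≤s {n = k-1} i≤k-1) =
    subst₂ (λ x y → x ∣ botLcm k * (y C k)) (sym (+-suc a i)) [1+a+i]+[k-1-i]≡a+k
      (1+m∣botLcm*[1+m+j]Ck (a + i) (k-1 ∸ i) k (s≤s (m∸n≤m k-1 i)))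
    where
    [1+a+i]+[k-1-i]≡a+k : suc (a + i) + (k-1 ∸ i) ≡ a + k
    [1+a+i]+[k-1-i]≡a+k = begin
      suc (a + i + (k-1 ∸ i))   ≡⟨ cong suc (+-assoc a i (k-1 ∸ i)) ⟩
      suc (a + (i + (k-1 ∸ i))) ≡⟨ cong (λ x → suc (a + x)) (m+[n∸m]≡n i≤k-1) ⟩
      suc (a + k-1)             ≡⟨ +-suc a k-1 ⟨
      a + k                     ∎
      where open ≡-Reasoning

theorem1 : (n k : ℕ) → k ≤ n →
    Σ ℕ (λ q → (q * botLcm k ≡ topLcm n k) × (q ∣ n C k))
theorem1 n k k≤n with botLcm∣lcmRange (n ∸ k) k
... | divides q top≡q*bot = q , sym top≡q*bot , *-cancelˡ-∣ (botLcm k) bot*q∣bot*C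
  where
  instance
    botLcm-nonZero : NonZero (botLcm k)
    botLcm-nonZero = ≢-nonZero (lcmRange≢0 0 k)
  bot*q∣bot*C : botLcm k * q ∣ botLcm k * (n C k)
  bot*q∣bot*C = subst₂ (λ x y → x ∣ botLcm k * (y C k))
    (trans top≡q*bot (*-comm q (botLcm k))) (m∸n+n≡m k≤n)
    (lcmRange∣botLcm*[a+k]Ck (n ∸ k) k)
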